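{- A directed graph $G=(V,E)$ is isomorphic to the transition graph of some reaction system if and only if the following three conditions hold: (1) $|V|=2^n$ for some $n\ge1$; (2) there is a faithful correspondence $\eta$ between $\mathcal O(G)$ and a family of upper cones of $(2^{[n]},\subseteq)$, i.e. a family $\mathrm{Up}[R]$ for some $R\subseteq 2^{[n]}$; (3) there are a vertex $v_\bot\in V\setminus\bigcup\{X\in\mathcal O(G)\mid X\neq V\}$ and a vertex $v_\top\in\bigcap\mathcal O(G)$ such that $(v_\bot,v_\bot)$ and $(v_\top,v_\bot)$ are edges of $G$.
   Context: $[n]=\{0,1,\dots,n-1\}$. For a directed graph $G=(V,E)$, $\mathrm{out}_G(v)=\{w\mid (v,w)\in E\}$ and $\mathcal O(G)=\{\mathrm{out}_G(v)\mid v\in V\}$. In the poset $(2^{[n]},\subseteq)$, $\mathrm{Up}(X)=\{Y\subseteq[n]\mid X\subseteq Y\}$ and $\mathrm{Up}[R]=\{\mathrm{Up}(X)\mid X\in R\}$. For a family $\mathcal O$, $\mathcal O^\cap$ is the smallest family containing $\mathcal O$ closed under intersection of two sets; a faithful correspondence between $\mathcal O_1$ and $\mathcal O_2$ is a bijection $\eta:\mathcal O_1^\cap\to\mathcal O_2^\cap$ with $|X|=|\eta(X)|$ and $\eta(X\cap Y)=\eta(X)\cap\eta(Y)$ for all $X,Y\in\mathcal O_1^\cap$. A reaction system is a pair $\mathcal A=(S,A)$ with $S$ a finite set and $A\subseteq(2^S\setminus\{\varnothing\})\times(2^S\setminus\{\varnothing\})\times 2^S$ a set of reactions $(R,I,P)$;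 $a=(R,I,P)$ is enabled in $X\subseteq S$ iff $R\subseteq X$ and $I\cap X=\varnothing$; $\mathrm{res}_a(X)=P$ if enabled and $\varnothing$ otherwise; $\mathrm{res}_{\mathcal A}(X)=\bigcup_{a\in A}\mathrm{res}_a(X)$. The transition graph of $\mathcal A$ is $G_{\mathcal A}$ with vertex set $2^S$ and edge set $\{(v,w)\mid v,w\in 2^S,\ \mathrm{res}_{\mathcal A}(v)\subseteq w\}$. -}

module Defs where

open import Data.Nat using (ℕ; zero; suc; _^_; _≥_)
open import Data.Bool using (Bool; true; false; if_then_else_; _∧_)
import Data.Bool as B
open import Data.Fin using (Fin)
open import Data.Fin.Subset using (Subset; _∈_; _∉_; _⊆_; _∩_; _∪_; ⊥; ⊤; ∣_∣; Nonempty)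
open import Data.Fin.Subset.Properties using (_⊆?_)
open import Data.Vec using (Vec; []; _∷_; _++_; map; lookup; tabulate; cast)
open import Data.Nat using (_+_)
open import Data.Nat.Properties using (+-identityʳ)
open import Data.Vec.Properties using (≡-dec)
open import Data.List using (List; foldr)
open import Data.List.Membership.Propositional using () renaming (_∈_ to _∈ₗ_)
open import Data.Product using (Σ; ∃; ∃-syntax; _×_; _,_)
open import Relation.Nullary using (¬_; Dec; yes; no)
open import Relation.Nullary.Decidable using (⌊_⌋)
open import Relation.Binary.PropositionalEquality using (_≡_; _≢_; cong; sym)
open import Function.Definitions using (Bijective)
open import Function.Bundles using (_⇔_)

-- Finite directed graphs.
-- A directed graph with vertex set V = Fin m is given by its out-neighbourhood
-- map: (v , w) ∈ E  iff  w ∈ out v.  Thus out_G(v) = out v.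

Graph : ℕ → Set
Graph m = Fin m → Subset m

𝒪 : ∀ {m} → Graph m → Subset m → Set
𝒪 {m} G X = ∃[ v ] G v ≡ X

data Cl {a : ℕ} (O : Subset a → Set) : Subset a → Set where
  base  : ∀ {X} → O X → Cl O X
  inter : ∀ {X Y} → Cl O X → Cl O Y → Cl O (X ∩ Y)

-- A faithful correspondence between O₁ and O₂: a bijection
-- η : O₁^∩ → O₂^∩ (given as a map on all subsets whose restriction to O₁^∩
-- is a bijection onto O₂^∩), preserving cardinality and intersections.
record FaithfulCorr {a b : ℕ} (O₁ : Subset a → Set) (O₂ : Subset b → Set)
                    (η : Subset a → Subset b) : Set where
  field
    into  : ∀ {X} → Cl O₁ X → Cl O₂ (η X)
    inj   : ∀ {X Y} → Cl O₁ X → Cl O₁ Y → η X ≡ η Y → X ≡ Y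
    surj  : ∀ {Z} → Cl O₂ Z → ∃[ X ] (Cl O₁ X × η X ≡ Z)
    card  : ∀ {X} → Cl O₁ X → ∣ X ∣ ≡ ∣ η X ∣
    hom   : ∀ {X Y} → Cl O₁ X → Cl O₁ Y → η (X ∩ Y) ≡ η X ∩ η Y

-- A subset of 2^[n] (a family of subsets of [n]) is
-- represented as a Subset (2 ^ n), where index i stands for the i-th element
-- of the fixed enumeration 'subsets n' of all 2 ^ n subsets of [n]
-- (an enumeration without repetitions).

subsets : ∀ n → Vec (Subset n) (2 ^ n)
subsets zero    = [] ∷ []
subsets (suc n) = cast (cong (2 ^ n +_) (sym (+-identityʳ (2 ^ n))))
  (map (false ∷_) (subsets n) ++ map (true ∷_) (subsets n))

Up : ∀ {n} → Subset n → Subset (2 ^ n)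
Up {n} X = tabulate (λ i → ⌊ X ⊆? lookup (subsets n) i ⌋)

UpFam : ∀ {n} → List (Subset n) → Subset (2 ^ n) → Set
UpFam R Z = ∃[ X ] (X ∈ₗ R × Up X ≡ Z)

record Reaction (s : ℕ) : Set where
  field
    R  : Subset s
    I  : Subset s
    P  : Subset s
    R≠∅ : Nonempty R
    I≠∅ : Nonempty I
open Reaction public

enabled? : ∀ {s} → Reaction s → Subset s → Bool
enabled? a X = ⌊ R a ⊆? X ⌋ ∧ ⌊ ≡-dec B._≟_ (I a ∩ X) ⊥ ⌋

res₁ : ∀ {s} → Reaction s → Subset s → Subset s
res₁ a X = if enabled? a X then P a else ⊥

res : ∀ {s} → List (Reaction s) → Subset s → Subset s
res A X = foldr (λ a acc → res₁ a X ∪ acc) ⊥ A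

TransEdge : ∀ {s} → List (Reaction s) → Subset s → Subset s → Set
TransEdge A v w = res A v ⊆ w

IsoToTrans : ∀ {m s} → Graph m → List (Reaction s) → Set
IsoToTrans {m} {s} G A =
  ∃[ f ] (Bijective {A = Fin m} {B = Subset s} _≡_ _≡_ f ×
          (∀ v w → (w ∈ G v) ⇔ TransEdge A (f v) (f w)))

-- G is isomorphic to the transition graph of some reaction system
-- (background set nonempty, w.l.o.g. S = Fin (suc k)).
IsRSTransitionGraph : ∀ {m} → Graph m → Set
IsRSTransitionGraph G = ∃[ k ] ∃[ A ] IsoToTrans {s = suc k} G A

Cond₃ : ∀ {m} → Graph m → Set
Cond₃ G =
  ∃[ v⊥ ] ∃[ v⊤ ]
    ( (∀ v → G v ≢ ⊤ → v⊥ ∉ G v)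
    × (∀ v → v⊤ ∈ G v)
    × v⊥ ∈ G v⊥
    × v⊥ ∈ G v⊤ )

Conditions : ∀ {m} → Graph m → Set
Conditions {m} G =
  ∃[ n ] ( n ≥ 1 × m ≡ 2 ^ n
         × (∃[ R ] ∃[ η ] FaithfulCorr (𝒪 G) (UpFam {n} R) η)
         × Cond₃ G )

-- An edge X → W of a transition graph means res(X) ⊆ W, so every out-neighbourhood is an
-- upper cone Up(res X).  Conversely every map g on 2^S is the result function of the system
-- with one reaction (X, S ∖ X, g X) for each X ≠ ∅, S, except at ∅ and S, where no reaction
-- can ever be enabled.  So G is a transition graph iff its vertices can be matched
-- bijectively with 2^[n] so that out(v) becomes Up(Y v), with Y v = ∅ at the vertices
-- matched with ∅ and [n].
--
-- Given η, the cone η(out v) = Up(Y v) is the candidate image of out(v).  As η preserves the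
-- sizes of all intersections of out-neighbourhoods, inclusion–exclusion shows that for each
-- c ⊆ V the vertices w with {v | w ∈ out v} = c and the points i of 2^[n] with
-- {v | i ∈ η(out v)} = c are equally many; matching them class by class gives the bijection.
-- Condition (3) puts v⊥ and v⊤ in the classes of ∅ and [n] and makes Y vanish at them, so the
-- matching can send them there.

module Submission where

open import Defs
open import Data.Bool using (Bool; true; false; _∧_; not; if_then_else_)
import Data.Bool as Bool
open import Data.Bool.Properties using (∧-zeroʳ)
open import Data.Empty using (⊥-elim)
open import Data.Fin using (Fin; zero; suc; punchIn; punchOut; join; splitAt; _↑ˡ_; _↑ʳ_)
import Data.Fin as Fin
open import Data.Fin.Permutation as Perm
  using (Permutation; _⟨$⟩ʳ_; _⟨$⟩ˡ_; permutation; remove; insert; insert-punchIn; inverseˡ; inverseʳ; ↔⇒≡)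
open import Data.Fin.Properties as Finₚ
  using (¬Fin0; punchIn-punchOut; splitAt-join; join-splitAt; cast-involutive)
open import Data.Fin.Subset using (Subset; _∈_; _∉_; _⊆_; _∩_; _∪_; ∁; ⊤; ⊥; ∣_∣; Nonempty)
open import Data.Fin.Subset.Properties
  using (_⊆?_; nonempty?; Empty-unique; ∣⊥∣≡0; ∣⊤∣≡n; ∣p∣≡n⇒p≡⊤;
         ⊆-antisym; ⊆-refl; ⊆-reflexive; ⊆⊤; ⊥⊆; ∈⊤; ∉⊥;
         x∈p∩q⁺; x∈p∩q⁻; x∈p∪q⁻; p⊆p∪q; q⊆p∪q; x∉∁p⇒x∈p;
         ∩-assoc; ∩-identityˡ; ∩-identityʳ; ∩-inverseˡ; ∪-identityˡ)
open import Data.List using (List; []; _∷_; allFin)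
import Data.List as List
open import Data.List.Membership.Propositional using () renaming (_∈_ to _∈ₗ_)
open import Data.List.Membership.Propositional.Properties using (∈-map⁺; ∈-map⁻; ∈-allFin)
open import Data.List.Relation.Unary.Any using (here; there)
open import Data.Nat using (ℕ; zero; suc; _+_; _^_; s≤s; z≤n)
open import Data.Nat.Properties using (suc-injective; +-suc; +-cancelʳ-≡; +-identityʳ)
open import Data.Product using (Σ; ∃; ∃₂; _×_; _,_; proj₁; proj₂)
open import Data.Sum using (_⊎_; inj₁; inj₂; [_,_]′)
open import Data.Sum.Properties using ([,]-cong)
open import Data.Vec using ([]; _∷_; lookup; tabulate; map; _++_; cast; toList)
open import Data.Vec.Properties
  using (lookup∘tabulate; tabulate∘lookup; tabulate-cong; []=⇒lookup; lookup⇒[]=;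
         lookup-zipWith; lookup-map; lookup-replicate; lookup-cast; lookup-splitAt; ≡-dec)
open import Data.Vec.Membership.Propositional.Properties using (∈-lookup; ∈-toList⁺)
open import Function using (_∘_; _⇔_; mk⇔; Equivalence; Injection)
open import Function.Definitions using (Bijective)
open import Function.Properties.Inverse using (↔⇒↣)
open import Relation.Binary.Definitions using (DecidableEquality)
open import Relation.Binary.PropositionalEquality
open import Relation.Nullary using (Dec; yes; no; does; ¬_; contradiction)
open import Relation.Nullary.Decidable using (dec-true; dec-false; isYes≗does; ⌊_⌋)
open ≡-Reasoning

∈-tabulate⁺ : ∀ {n} {f : Fin n → Bool} {i} → f i ≡ true → i ∈ tabulate f
∈-tabulate⁺ {f = f} {i} fi = lookup⇒[]= i (tabulate f) (trans (lookup∘tabulate f i) fi)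

∈-tabulate⁻ : ∀ {n} {f : Fin n → Bool} {i} → i ∈ tabulate f → f i ≡ true
∈-tabulate⁻ {f = f} {i} i∈ = trans (sym (lookup∘tabulate f i)) ([]=⇒lookup i∈)

∣∷∣-cong : ∀ {m n} x (p : Subset m) (q : Subset n) → ∣ p ∣ ≡ ∣ q ∣ → ∣ x ∷ p ∣ ≡ ∣ x ∷ q ∣
∣∷∣-cong true  p q e = cong suc e
∣∷∣-cong false p q e = e

∣∷∣-cancel : ∀ {m n} x (p : Subset m) (q : Subset n) → ∣ x ∷ p ∣ ≡ ∣ x ∷ q ∣ → ∣ p ∣ ≡ ∣ q ∣
∣∷∣-cancel true  p q e = suc-injective e
∣∷∣-cancel false p q e = e

∣x∷y∷p∣≡∣y∷x∷p∣ : ∀ {n} x y (p : Subset n) → ∣ x ∷ y ∷ p ∣ ≡ ∣ y ∷ x ∷ p ∣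
∣x∷y∷p∣≡∣y∷x∷p∣ true  true  p = refl
∣x∷y∷p∣≡∣y∷x∷p∣ true  false p = refl
∣x∷y∷p∣≡∣y∷x∷p∣ false true  p = refl
∣x∷y∷p∣≡∣y∷x∷p∣ false false p = refl

∣tabulate∣-punchIn : ∀ {n} (f : Fin (suc n) → Bool) i →
                     ∣ f i ∷ tabulate (f ∘ punchIn i) ∣ ≡ ∣ tabulate f ∣
∣tabulate∣-punchIn f zero = refl
∣tabulate∣-punchIn {suc n} f (suc i) = begin
  ∣ f (suc i) ∷ f zero ∷ tabulate (f ∘ suc ∘ punchIn i) ∣
    ≡⟨ ∣x∷y∷p∣≡∣y∷x∷p∣ (f (suc i)) (f zero) (tabulate (f ∘ suc ∘ punchIn i)) ⟩
  ∣ f zero ∷ f (suc i) ∷ tabulate (f ∘ suc ∘ punchIn i) ∣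
    ≡⟨ ∣∷∣-cong (f zero) (f (suc i) ∷ tabulate (f ∘ suc ∘ punchIn i)) (tabulate (f ∘ suc))
                 (∣tabulate∣-punchIn (f ∘ suc) i) ⟩
  ∣ tabulate f ∣ ∎

∣tabulate∣-permute : ∀ {m n} (π : Permutation m n) (f : Fin n → Bool) →
                     ∣ tabulate (f ∘ (π ⟨$⟩ʳ_)) ∣ ≡ ∣ tabulate f ∣
∣tabulate∣-permute {zero}  {zero}  π f = refl
∣tabulate∣-permute {zero}  {suc n} π f = contradiction (π ⟨$⟩ˡ zero) ¬Fin0
∣tabulate∣-permute {suc m} {zero}  π f = contradiction (π ⟨$⟩ʳ zero) ¬Fin0
∣tabulate∣-permute {suc m} {suc n} π f = begin
  ∣ f j ∷ tabulate (f ∘ (π ⟨$⟩ʳ_) ∘ suc) ∣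
    ≡⟨ cong (λ p → ∣ f j ∷ p ∣) (tabulate-cong (cong f ∘ π∘suc)) ⟩
  ∣ f j ∷ tabulate (f ∘ punchIn j ∘ (ρ ⟨$⟩ʳ_)) ∣
    ≡⟨ ∣∷∣-cong (f j) (tabulate (f ∘ punchIn j ∘ (ρ ⟨$⟩ʳ_))) (tabulate (f ∘ punchIn j))
                 (∣tabulate∣-permute ρ (f ∘ punchIn j)) ⟩
  ∣ f j ∷ tabulate (f ∘ punchIn j) ∣
    ≡⟨ ∣tabulate∣-punchIn f j ⟩
  ∣ tabulate f ∣ ∎
  where
  j : Fin (suc n)
  j = π ⟨$⟩ʳ zero
  ρ : Permutation m n
  ρ = remove zero π
  π∘suc : ∀ i → π ⟨$⟩ʳ suc i ≡ punchIn j (ρ ⟨$⟩ʳ i)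
  π∘suc i = sym (punchIn-punchOut _)

∣p∩∁q∩r∣+∣p∩q∩r∣≡∣p∩r∣ : ∀ {n} (p q r : Subset n) → ∣ p ∩ (∁ q ∩ r) ∣ + ∣ p ∩ (q ∩ r) ∣ ≡ ∣ p ∩ r ∣
∣p∩∁q∩r∣+∣p∩q∩r∣≡∣p∩r∣ []            []            []            = refl
∣p∩∁q∩r∣+∣p∩q∩r∣≡∣p∩r∣ (false ∷ p) (_     ∷ q) (_     ∷ r) = ∣p∩∁q∩r∣+∣p∩q∩r∣≡∣p∩r∣ p q r
∣p∩∁q∩r∣+∣p∩q∩r∣≡∣p∩r∣ (true  ∷ p) (true  ∷ q) (true  ∷ r) =
  trans (+-suc _ _) (cong suc (∣p∩∁q∩r∣+∣p∩q∩r∣≡∣p∩r∣ p q r))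
∣p∩∁q∩r∣+∣p∩q∩r∣≡∣p∩r∣ (true  ∷ p) (false ∷ q) (true  ∷ r) = cong suc (∣p∩∁q∩r∣+∣p∩q∩r∣≡∣p∩r∣ p q r)
∣p∩∁q∩r∣+∣p∩q∩r∣≡∣p∩r∣ (true  ∷ p) (true  ∷ q) (false ∷ r) = ∣p∩∁q∩r∣+∣p∩q∩r∣≡∣p∩r∣ p q r
∣p∩∁q∩r∣+∣p∩q∩r∣≡∣p∩r∣ (true  ∷ p) (false ∷ q) (false ∷ r) = ∣p∩∁q∩r∣+∣p∩q∩r∣≡∣p∩r∣ p q r

∪-lub : ∀ {n} {p q r : Subset n} → p ⊆ r → q ⊆ r → p ∪ q ⊆ r
∪-lub {p = p} {q} p⊆r q⊆r x∈ = [ p⊆r , q⊆r ]′ (x∈p∪q⁻ p q x∈)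

preimage : ∀ {m n} → (Fin m → Fin n) → Subset n → Subset m
preimage h p = tabulate (lookup p ∘ h)

∈-preimage⁺ : ∀ {m n} {h : Fin m → Fin n} {p i} → h i ∈ p → i ∈ preimage h p
∈-preimage⁺ hi∈ = ∈-tabulate⁺ ([]=⇒lookup hi∈)

∈-preimage⁻ : ∀ {m n} {h : Fin m → Fin n} {p i} → i ∈ preimage h p → h i ∈ p
∈-preimage⁻ {h = h} {p} {i} i∈ = lookup⇒[]= (h i) p (∈-tabulate⁻ i∈)

preimage-∩ : ∀ {m n} (h : Fin m → Fin n) (p q : Subset n) → preimage h (p ∩ q) ≡ preimage h p ∩ preimage h q
preimage-∩ h p q = ⊆-antisym
  (λ i∈ → let hi∈p , hi∈q = x∈p∩q⁻ p q (∈-preimage⁻ {h = h} i∈)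
          in x∈p∩q⁺ (∈-preimage⁺ {h = h} hi∈p , ∈-preimage⁺ {h = h} hi∈q))
  (λ i∈ → let i∈p , i∈q = x∈p∩q⁻ (preimage h p) (preimage h q) i∈
          in ∈-preimage⁺ {h = h} {p ∩ q} (x∈p∩q⁺ (∈-preimage⁻ {h = h} i∈p , ∈-preimage⁻ {h = h} i∈q)))

∣preimage∣ : ∀ {m n} (π : Permutation m n) (p : Subset n) → ∣ preimage (π ⟨$⟩ʳ_) p ∣ ≡ ∣ p ∣
∣preimage∣ π p = trans (∣tabulate∣-permute π (lookup p)) (cong ∣_∣ (tabulate∘lookup p))

preimage-injective : ∀ {m n} (π : Permutation m n) {p q : Subset n} →
                     preimage (π ⟨$⟩ʳ_) p ≡ preimage (π ⟨$⟩ʳ_) q → p ≡ q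
preimage-injective π e = ⊆-antisym (included e) (included (sym e))
  where
  included : ∀ {p q} → preimage (π ⟨$⟩ʳ_) p ≡ preimage (π ⟨$⟩ʳ_) q → p ⊆ q
  included {p} {q} e x∈p = subst (_∈ q) (inverseʳ π) (∈-preimage⁻ {h = π ⟨$⟩ʳ_}
    (subst (_ ∈_) e (∈-preimage⁺ {h = π ⟨$⟩ʳ_} {p} (subst (_∈ p) (sym (inverseʳ π)) x∈p))))

does-sound : ∀ {A : Set} (a? : Dec A) → does a? ≡ true → A
does-sound (yes a) _ = a

⌊⌋-sound : ∀ {A : Set} (a? : Dec A) → ⌊ a? ⌋ ≡ true → A
⌊⌋-sound a? e = does-sound a? (trans (sym (isYes≗does a?)) e)

⌊⌋-complete : ∀ {A : Set} (a? : Dec A) → A → ⌊ a? ⌋ ≡ true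
⌊⌋-complete a? a = trans (isYes≗does a?) (dec-true a? a)

⌊⌋-refute : ∀ {A : Set} (a? : Dec A) → ¬ A → ⌊ a? ⌋ ≡ false
⌊⌋-refute a? ¬a = trans (isYes≗does a?) (dec-false a? ¬a)

x≡does-x≟true : ∀ x → x ≡ does (x Bool.≟ true)
x≡does-x≟true true  = refl
x≡does-x≟true false = refl

not-x≡does-x≟false : ∀ x → not x ≡ does (x Bool.≟ false)
not-x≡does-x≟false true  = refl
not-x≡does-x≟false false = refl

∧≡true : ∀ {x y} → x ∧ y ≡ true → x ≡ true × y ≡ true
∧≡true {true} {true} refl = refl , refl

-- Matching two maps with equal fibres

insert-self : ∀ {m n} i j (ρ : Permutation m n) → insert i j ρ ⟨$⟩ʳ i ≡ j
insert-self i j ρ with i Finₚ.≟ i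
... | yes _   = refl
... | no i≢i = contradiction refl i≢i

⟨$⟩ʳ-injective : ∀ {m n} (π : Permutation m n) {i j} → π ⟨$⟩ʳ i ≡ π ⟨$⟩ʳ j → i ≡ j
⟨$⟩ʳ-injective π = Injection.injective (↔⇒↣ π)

module Fibres {C : Set} (_≟_ : DecidableEquality C) where

  fibre : ∀ {m} → (Fin m → C) → C → Subset m
  fibre p x = tabulate (λ i → does (p i ≟ x))

  SameFibres : ∀ {m n} → (Fin m → C) → (Fin n → C) → Set
  SameFibres p q = ∀ x → ∣ fibre p x ∣ ≡ ∣ fibre q x ∣

  Matches : ∀ {m n} → Permutation m n → (Fin m → C) → (Fin n → C) → Set
  Matches π p q = ∀ i → q (π ⟨$⟩ʳ i) ≡ p i

  ∣fibre∣-punchIn : ∀ {m} (p : Fin (suc m) → C) i x →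
                    ∣ does (p i ≟ x) ∷ fibre (p ∘ punchIn i) x ∣ ≡ ∣ fibre p x ∣
  ∣fibre∣-punchIn p i x = ∣tabulate∣-punchIn (λ k → does (p k ≟ x)) i

  SameFibres-punchIn : ∀ {m n} {p : Fin (suc m) → C} {q : Fin (suc n) → C} {i j} →
                       p i ≡ q j → SameFibres p q → SameFibres (p ∘ punchIn i) (q ∘ punchIn j)
  SameFibres-punchIn {p = p} {q} {i} {j} pi≡qj same x =
    ∣∷∣-cancel (does (p i ≟ x)) (fibre (p ∘ punchIn i) x) (fibre (q ∘ punchIn j) x) (begin
    ∣ does (p i ≟ x) ∷ fibre (p ∘ punchIn i) x ∣ ≡⟨ ∣fibre∣-punchIn p i x ⟩
    ∣ fibre p x ∣                                ≡⟨ same x ⟩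
    ∣ fibre q x ∣                                ≡⟨ ∣fibre∣-punchIn q j x ⟨
    ∣ does (q j ≟ x) ∷ fibre (q ∘ punchIn j) x ∣ ≡⟨ cong (λ y → ∣ does (y ≟ x) ∷ fibre (q ∘ punchIn j) x ∣) pi≡qj ⟨
    ∣ does (p i ≟ x) ∷ fibre (q ∘ punchIn j) x ∣ ∎)

  fibre-hit : ∀ {m n} (p : Fin m → C) (q : Fin n → C) i → SameFibres p q → ∃ λ j → q j ≡ p i
  fibre-hit {suc m} {n} p q i same with nonempty? (fibre q (p i))
  ... | yes (j , j∈) = j , does-sound (q j ≟ p i) (∈-tabulate⁻ j∈)
  ... | no empty = contradiction (begin
        suc ∣ fibre (p ∘ punchIn i) (p i) ∣
          ≡⟨ cong (λ b → ∣ b ∷ fibre (p ∘ punchIn i) (p i) ∣) (dec-true (p i ≟ p i) refl) ⟨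
        ∣ does (p i ≟ p i) ∷ fibre (p ∘ punchIn i) (p i) ∣ ≡⟨ ∣fibre∣-punchIn p i (p i) ⟩
        ∣ fibre p (p i) ∣                              ≡⟨ same (p i) ⟩
        ∣ fibre q (p i) ∣                              ≡⟨ cong ∣_∣ (Empty-unique empty) ⟩
        ∣ ⊥ {n} ∣                                      ≡⟨ ∣⊥∣≡0 n ⟩
        0                                              ∎) λ ()

  insert-matches : ∀ {m n} {p : Fin (suc m) → C} {q : Fin (suc n) → C} {i j} {ρ : Permutation m n} →
                   p i ≡ q j → Matches ρ (p ∘ punchIn i) (q ∘ punchIn j) → Matches (insert i j ρ) p q
  insert-matches {p = p} {i = i} pi≡qj ρ-matches k with i Finₚ.≟ k
  ... | yes refl = sym pi≡qj
  ... | no i≢k = trans (ρ-matches (punchOut i≢k)) (cong p (punchIn-punchOut i≢k))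

  matching : ∀ {m n} (p : Fin m → C) (q : Fin n → C) → SameFibres p q →
             Σ (Permutation m n) λ π → Matches π p q
  matching-through : ∀ {m n} (p : Fin m → C) (q : Fin n → C) {i j} → p i ≡ q j → SameFibres p q →
                     Σ (Permutation m n) λ π → Matches π p q × π ⟨$⟩ʳ i ≡ j

  matching {zero}  {zero}  p q same = Perm.id , λ ()
  matching {zero}  {suc n} p q same with () ← proj₁ (fibre-hit q p zero (sym ∘ same))
  matching {suc m}         p q same =
    let j , qj≡p0 = fibre-hit p q zero same
        π , π-matches , _ = matching-through p q (sym qj≡p0) same
    in π , π-matches

  matching-through {suc m} {suc n} p q {i} {j} pi≡qj same =
    let ρ , ρ-matches = matching (p ∘ punchIn i) (q ∘ punchIn j) (SameFibres-punchIn {p = p} {q} pi≡qj same)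
    in insert i j ρ , insert-matches {p = p} {q} pi≡qj ρ-matches , insert-self i j ρ

  matching-through₂ : ∀ {m n} (p : Fin m → C) (q : Fin n → C) {i₁ i₂ j₁ j₂} → i₁ ≢ i₂ → j₁ ≢ j₂ →
                      p i₁ ≡ q j₁ → p i₂ ≡ q j₂ → SameFibres p q →
                      Σ (Permutation m n) λ π → Matches π p q × π ⟨$⟩ʳ i₁ ≡ j₁ × π ⟨$⟩ʳ i₂ ≡ j₂
  matching-through₂ {suc m} {suc n} p q {i₁} {i₂} {j₁} {j₂} i₁≢i₂ j₁≢j₂ p₁≡q₁ p₂≡q₂ same =
    let ρ , ρ-matches , ρ-i₂′ = matching-through (p ∘ punchIn i₁) (q ∘ punchIn j₁) p₂′≡q₂′
                                  (SameFibres-punchIn {p = p} {q} p₁≡q₁ same)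
    in insert i₁ j₁ ρ , insert-matches {p = p} {q} p₁≡q₁ ρ-matches , insert-self i₁ j₁ ρ , insert-i₂ ρ ρ-i₂′
    where
    i₂′ : Fin m
    i₂′ = punchOut i₁≢i₂
    j₂′ : Fin n
    j₂′ = punchOut j₁≢j₂
    p₂′≡q₂′ : p (punchIn i₁ i₂′) ≡ q (punchIn j₁ j₂′)
    p₂′≡q₂′ = trans (cong p (punchIn-punchOut i₁≢i₂)) (trans p₂≡q₂ (cong q (sym (punchIn-punchOut j₁≢j₂))))
    insert-i₂ : ∀ ρ → ρ ⟨$⟩ʳ i₂′ ≡ j₂′ → insert i₁ j₁ ρ ⟨$⟩ʳ i₂ ≡ j₂
    insert-i₂ ρ ρ-i₂′ = begin
      insert i₁ j₁ ρ ⟨$⟩ʳ i₂               ≡⟨ cong (insert i₁ j₁ ρ ⟨$⟩ʳ_) (punchIn-punchOut i₁≢i₂) ⟨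
      insert i₁ j₁ ρ ⟨$⟩ʳ punchIn i₁ i₂′   ≡⟨ insert-punchIn i₁ j₁ ρ i₂′ ⟩
      punchIn j₁ (ρ ⟨$⟩ʳ i₂′)              ≡⟨ cong (punchIn j₁) ρ-i₂′ ⟩
      punchIn j₁ j₂′                       ≡⟨ punchIn-punchOut j₁≢j₂ ⟩
      j₂                                   ∎

-- Atoms of a finite family of subsets

meet : ∀ {k a} → Subset k → (Fin k → Subset a) → Subset a
meet []          Xs = ⊤
meet (true  ∷ J) Xs = Xs zero ∩ meet J (Xs ∘ suc)
meet (false ∷ J) Xs = meet J (Xs ∘ suc)

literal : ∀ {a} → Bool → Subset a → Subset a
literal true  X = X
literal false X = ∁ X

atom : ∀ {k a} → Subset k → (Fin k → Subset a) → Subset a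
atom []      Xs = ⊤
atom (b ∷ c) Xs = literal b (Xs zero) ∩ atom c (Xs ∘ suc)

column : ∀ {k a} → (Fin k → Subset a) → Fin a → Subset k
column Xs w = tabulate (λ v → lookup (Xs v) w)

∈-column⁺ : ∀ {k a} {Xs : Fin k → Subset a} {v w} → w ∈ Xs v → v ∈ column Xs w
∈-column⁺ w∈ = ∈-tabulate⁺ ([]=⇒lookup w∈)

∈-column⁻ : ∀ {k a} {Xs : Fin k → Subset a} {v w} → v ∈ column Xs w → w ∈ Xs v
∈-column⁻ {Xs = Xs} {v} {w} v∈ = lookup⇒[]= w (Xs v) (∈-tabulate⁻ v∈)

column-≡ : ∀ {k a b} {Xs : Fin k → Subset a} {Ys : Fin k → Subset b} {w w′} →
           (∀ v → (w ∈ Xs v) ⇔ (w′ ∈ Ys v)) → column Xs w ≡ column Ys w′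
column-≡ {Xs = Xs} {Ys} iff =
  ⊆-antisym (λ {v} v∈ → ∈-column⁺ {Xs = Ys} (Equivalence.to   (iff v) (∈-column⁻ {Xs = Xs} v∈)))
            (λ {v} v∈ → ∈-column⁺ {Xs = Xs} (Equivalence.from (iff v) (∈-column⁻ {Xs = Ys} v∈)))

open module SubsetFibres {k : ℕ} = Fibres (≡-dec {n = k} Bool._≟_)

lookup-literal : ∀ {a} b (X : Subset a) w → lookup (literal b X) w ≡ does (lookup X w Bool.≟ b)
lookup-literal true  X w = x≡does-x≟true (lookup X w)
lookup-literal false X w = trans (lookup-map w not X) (not-x≡does-x≟false (lookup X w))

lookup-atom : ∀ {k a} c (Xs : Fin k → Subset a) w → lookup (atom c Xs) w ≡ does (≡-dec Bool._≟_ (column Xs w) c)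
lookup-atom []      Xs w = lookup-replicate w true
lookup-atom (b ∷ c) Xs w = begin
  lookup (literal b (Xs zero) ∩ atom c (Xs ∘ suc)) w
    ≡⟨ lookup-zipWith _∧_ w (literal b (Xs zero)) (atom c (Xs ∘ suc)) ⟩
  lookup (literal b (Xs zero)) w ∧ lookup (atom c (Xs ∘ suc)) w
    ≡⟨ cong₂ _∧_ (lookup-literal b (Xs zero) w) (lookup-atom c (Xs ∘ suc) w) ⟩
  does (lookup (Xs zero) w Bool.≟ b) ∧ does (≡-dec Bool._≟_ (column (Xs ∘ suc) w) c) ∎

atom≡fibre : ∀ {k a} c (Xs : Fin k → Subset a) → atom c Xs ≡ fibre (column Xs) c
atom≡fibre c Xs = trans (sym (tabulate∘lookup (atom c Xs))) (tabulate-cong (lookup-atom c Xs))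

-- Inclusion–exclusion, by induction on the number of sets.
atom-sizes : ∀ {k m n} (Xs : Fin k → Subset m) (Ys : Fin k → Subset n) U V →
             (∀ J → ∣ U ∩ meet J Xs ∣ ≡ ∣ V ∩ meet J Ys ∣) →
             ∀ c → ∣ U ∩ atom c Xs ∣ ≡ ∣ V ∩ atom c Ys ∣
atom-sizes Xs Ys U V same []      = same []
atom-sizes {m = m} {n} Xs Ys U V same (b ∷ c) = atom-sizes-∷ b
  where
  X₀ A : Subset m
  X₀ = Xs zero
  A = atom c (Xs ∘ suc)
  Y₀ B : Subset n
  Y₀ = Ys zero
  B = atom c (Ys ∘ suc)

  inside : ∣ U ∩ (X₀ ∩ A) ∣ ≡ ∣ V ∩ (Y₀ ∩ B) ∣
  inside = begin
    ∣ U ∩ (X₀ ∩ A) ∣ ≡⟨ cong ∣_∣ (∩-assoc U X₀ A) ⟨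
    ∣ (U ∩ X₀) ∩ A ∣ ≡⟨ atom-sizes (Xs ∘ suc) (Ys ∘ suc) (U ∩ X₀) (V ∩ Y₀) same-inside c ⟩
    ∣ (V ∩ Y₀) ∩ B ∣ ≡⟨ cong ∣_∣ (∩-assoc V Y₀ B) ⟩
    ∣ V ∩ (Y₀ ∩ B) ∣ ∎
    where
    same-inside : ∀ J → ∣ (U ∩ X₀) ∩ meet J (Xs ∘ suc) ∣ ≡ ∣ (V ∩ Y₀) ∩ meet J (Ys ∘ suc) ∣
    same-inside J = begin
      ∣ (U ∩ X₀) ∩ meet J (Xs ∘ suc) ∣ ≡⟨ cong ∣_∣ (∩-assoc U X₀ _) ⟩
      ∣ U ∩ meet (true ∷ J) Xs ∣       ≡⟨ same (true ∷ J) ⟩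
      ∣ V ∩ meet (true ∷ J) Ys ∣       ≡⟨ cong ∣_∣ (∩-assoc V Y₀ _) ⟨
      ∣ (V ∩ Y₀) ∩ meet J (Ys ∘ suc) ∣ ∎

  atom-sizes-∷ : ∀ b → ∣ U ∩ atom (b ∷ c) Xs ∣ ≡ ∣ V ∩ atom (b ∷ c) Ys ∣
  atom-sizes-∷ true  = inside
  atom-sizes-∷ false = +-cancelʳ-≡ ∣ U ∩ (X₀ ∩ A) ∣ _ _ (begin
    ∣ U ∩ (∁ X₀ ∩ A) ∣ + ∣ U ∩ (X₀ ∩ A) ∣ ≡⟨ ∣p∩∁q∩r∣+∣p∩q∩r∣≡∣p∩r∣ U X₀ A ⟩
    ∣ U ∩ A ∣                             ≡⟨ atom-sizes (Xs ∘ suc) (Ys ∘ suc) U V (same ∘ (false ∷_)) c ⟩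
    ∣ V ∩ B ∣                             ≡⟨ ∣p∩∁q∩r∣+∣p∩q∩r∣≡∣p∩r∣ V Y₀ B ⟨
    ∣ V ∩ (∁ Y₀ ∩ B) ∣ + ∣ V ∩ (Y₀ ∩ B) ∣ ≡⟨ cong (∣ V ∩ (∁ Y₀ ∩ B) ∣ +_) inside ⟨
    ∣ V ∩ (∁ Y₀ ∩ B) ∣ + ∣ U ∩ (X₀ ∩ A) ∣ ∎)

module _ {a} {O₁ O₂ : Subset a → Set} {η : Subset a → Subset a} (fc : FaithfulCorr O₁ O₂ η) where

  open FaithfulCorr fc

  -- The empty meet is the whole ground set, which need not lie in the closure.
  meet-η : ∀ {k} J (Xs : Fin k → Subset a) → (∀ v → O₁ (Xs v)) →
           (meet J Xs ≡ ⊤ × meet J (η ∘ Xs) ≡ ⊤) ⊎ (Cl O₁ (meet J Xs) × η (meet J Xs) ≡ meet J (η ∘ Xs))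
  meet-η []          Xs gen = inj₁ (refl , refl)
  meet-η (false ∷ J) Xs gen = meet-η J (Xs ∘ suc) (gen ∘ suc)
  meet-η (true  ∷ J) Xs gen with meet-η J (Xs ∘ suc) (gen ∘ suc)
  ... | inj₁ (M≡⊤ , M′≡⊤) rewrite M≡⊤ | M′≡⊤ | ∩-identityʳ (Xs zero) | ∩-identityʳ (η (Xs zero)) =
    inj₂ (base (gen zero) , refl)
  ... | inj₂ (M∈ , ηM≡M′) =
    inj₂ (inter (base (gen zero)) M∈ , trans (hom (base (gen zero)) M∈) (cong (η (Xs zero) ∩_) ηM≡M′))

  ∣meet∣-preserved : ∀ {k} (Xs : Fin k → Subset a) → (∀ v → O₁ (Xs v)) →
                     ∀ J → ∣ meet J Xs ∣ ≡ ∣ meet J (η ∘ Xs) ∣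
  ∣meet∣-preserved Xs gen J with meet-η J Xs gen
  ... | inj₁ (M≡⊤ , M′≡⊤) = trans (cong ∣_∣ M≡⊤) (sym (cong ∣_∣ M′≡⊤))
  ... | inj₂ (M∈ , ηM≡M′) = trans (card M∈) (cong ∣_∣ ηM≡M′)

  column-fibres : ∀ {k} (Xs : Fin k → Subset a) → (∀ v → O₁ (Xs v)) → SameFibres (column Xs) (column (η ∘ Xs))
  column-fibres Xs gen c = begin
    ∣ fibre (column Xs) c ∣       ≡⟨ cong ∣_∣ (atom≡fibre c Xs) ⟨
    ∣ atom c Xs ∣                 ≡⟨ cong ∣_∣ (∩-identityˡ (atom c Xs)) ⟨
    ∣ ⊤ ∩ atom c Xs ∣             ≡⟨ atom-sizes Xs (η ∘ Xs) ⊤ ⊤ same c ⟩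
    ∣ ⊤ ∩ atom c (η ∘ Xs) ∣       ≡⟨ cong ∣_∣ (∩-identityˡ (atom c (η ∘ Xs))) ⟩
    ∣ atom c (η ∘ Xs) ∣           ≡⟨ cong ∣_∣ (atom≡fibre c (η ∘ Xs)) ⟩
    ∣ fibre (column (η ∘ Xs)) c ∣ ∎
    where
    same : ∀ J → ∣ ⊤ ∩ meet J Xs ∣ ≡ ∣ ⊤ ∩ meet J (η ∘ Xs) ∣
    same J = begin
      ∣ ⊤ ∩ meet J Xs ∣       ≡⟨ cong ∣_∣ (∩-identityˡ (meet J Xs)) ⟩
      ∣ meet J Xs ∣           ≡⟨ ∣meet∣-preserved Xs gen J ⟩
      ∣ meet J (η ∘ Xs) ∣     ≡⟨ cong ∣_∣ (∩-identityˡ (meet J (η ∘ Xs))) ⟨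
      ∣ ⊤ ∩ meet J (η ∘ Xs) ∣ ∎

  full-preserved : ∀ {X} → Cl O₁ X → X ≡ ⊤ → η X ≡ ⊤
  full-preserved X∈ refl = ∣p∣≡n⇒p≡⊤ (trans (sym (card X∈)) (∣⊤∣≡n a))

  full-reflected : ∀ {X} → Cl O₁ X → η X ≡ ⊤ → X ≡ ⊤
  full-reflected X∈ ηX≡⊤ = ∣p∣≡n⇒p≡⊤ (trans (card X∈) (trans (cong ∣_∣ ηX≡⊤) (∣⊤∣≡n a)))

faithfulCorr : ∀ {a b} {O₁ : Subset a → Set} {O₂ : Subset b → Set} {η : Subset a → Subset b} →
               (∀ X Y → η (X ∩ Y) ≡ η X ∩ η Y) → (∀ {X Y} → η X ≡ η Y → X ≡ Y) →
               (∀ X → ∣ X ∣ ≡ ∣ η X ∣) →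
               (∀ {X} → O₁ X → O₂ (η X)) → (∀ {Z} → O₂ Z → ∃ λ X → O₁ X × η X ≡ Z) →
               FaithfulCorr O₁ O₂ η
faithfulCorr {O₁ = O₁} {O₂} {η} η-∩ η-inj η-card η-gen η-gen⁻¹ = record
  { into = into
  ; inj  = λ _ _ → η-inj
  ; surj = surj
  ; card = λ {X} _ → η-card X
  ; hom  = λ {X} {Y} _ _ → η-∩ X Y
  }
  where
  into : ∀ {X} → Cl O₁ X → Cl O₂ (η X)
  into (base X∈)             = base (η-gen X∈)
  into (inter {X} {Y} X∈ Y∈) = subst (Cl O₂) (sym (η-∩ X Y)) (inter (into X∈) (into Y∈))
  surj : ∀ {Z} → Cl O₂ Z → ∃ λ X → Cl O₁ X × η X ≡ Z
  surj (base Z∈) = let X , X∈ , ηX≡Z = η-gen⁻¹ Z∈ in X , base X∈ , ηX≡Z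
  surj (inter Z₁∈ Z₂∈) =
    let X₁ , X₁∈ , ηX₁≡Z₁ = surj Z₁∈
        X₂ , X₂∈ , ηX₂≡Z₂ = surj Z₂∈
    in X₁ ∩ X₂ , inter X₁∈ X₂∈ , trans (η-∩ X₁ X₂) (cong₂ _∩_ ηX₁≡Z₁ ηX₂≡Z₂)

-- The enumeration of 2^[n] and upper cones

2ⁿ+2ⁿ≡2ⁿ⁺¹ : ∀ n → 2 ^ n + 2 ^ n ≡ 2 ^ suc n
2ⁿ+2ⁿ≡2ⁿ⁺¹ n = cong (2 ^ n +_) (sym (+-identityʳ (2 ^ n)))

subsetAt : ∀ n → Fin (2 ^ n) → Subset n
subsetAt n = lookup (subsets n)

-- subsets (suc n) lists the subsets without 0 before those containing it.
half : ∀ {m} → Bool → Fin m → Fin m ⊎ Fin m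
half false = inj₁
half true  = inj₂

subsetAt⊎ : ∀ n → Fin (2 ^ n) ⊎ Fin (2 ^ n) → Subset (suc n)
subsetAt⊎ n = [ (false ∷_) ∘ subsetAt n , (true ∷_) ∘ subsetAt n ]′

indexOf : ∀ {n} → Subset n → Fin (2 ^ n)
indexOf []              = zero
indexOf {suc n} (b ∷ X) = Fin.cast (2ⁿ+2ⁿ≡2ⁿ⁺¹ n) (join (2 ^ n) (2 ^ n) (half b (indexOf X)))

subsetAt-cast : ∀ {n} (i : Fin (2 ^ n + 2 ^ n)) →
                subsetAt (suc n) (Fin.cast (2ⁿ+2ⁿ≡2ⁿ⁺¹ n) i) ≡ subsetAt⊎ n (splitAt (2 ^ n) i)
subsetAt-cast {n} i = begin
  lookup (cast _ (map (false ∷_) (subsets n) ++ map (true ∷_) (subsets n))) (Fin.cast (2ⁿ+2ⁿ≡2ⁿ⁺¹ n) i)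
    ≡⟨ lookup-cast (2ⁿ+2ⁿ≡2ⁿ⁺¹ n) _ i ⟩
  lookup (map (false ∷_) (subsets n) ++ map (true ∷_) (subsets n)) i
    ≡⟨ lookup-splitAt (2 ^ n) (map (false ∷_) (subsets n)) (map (true ∷_) (subsets n)) i ⟩
  [ lookup (map (false ∷_) (subsets n)) , lookup (map (true ∷_) (subsets n)) ]′ (splitAt (2 ^ n) i)
    ≡⟨ [,]-cong (λ j → lookup-map j _ (subsets n)) (λ j → lookup-map j _ (subsets n)) (splitAt (2 ^ n) i) ⟩
  subsetAt⊎ n (splitAt (2 ^ n) i) ∎

subsetAt-indexOf : ∀ {n} (X : Subset n) → subsetAt n (indexOf X) ≡ X
subsetAt-indexOf []              = refl
subsetAt-indexOf {suc n} (b ∷ X) = begin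
  subsetAt (suc n) (Fin.cast (2ⁿ+2ⁿ≡2ⁿ⁺¹ n) (join (2 ^ n) (2 ^ n) (half b (indexOf X))))
    ≡⟨ subsetAt-cast {n} (join (2 ^ n) (2 ^ n) (half b (indexOf X))) ⟩
  subsetAt⊎ n (splitAt (2 ^ n) (join (2 ^ n) (2 ^ n) (half b (indexOf X))))
    ≡⟨ cong (subsetAt⊎ n) (splitAt-join (2 ^ n) (2 ^ n) (half b (indexOf X))) ⟩
  subsetAt⊎ n (half b (indexOf X))
    ≡⟨ choose b ⟩
  b ∷ subsetAt n (indexOf X)
    ≡⟨ cong (b ∷_) (subsetAt-indexOf X) ⟩
  b ∷ X ∎
  where
  choose : ∀ b → subsetAt⊎ n (half b (indexOf X)) ≡ b ∷ subsetAt n (indexOf X)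
  choose false = refl
  choose true  = refl

indexOf-subsetAt : ∀ {n} (i : Fin (2 ^ n)) → indexOf (subsetAt n i) ≡ i
indexOf-subsetAt {zero}  zero = refl
indexOf-subsetAt {suc n} i    = begin
  indexOf (subsetAt (suc n) i)
    ≡⟨ cong (indexOf ∘ subsetAt (suc n)) (cast-involutive (2ⁿ+2ⁿ≡2ⁿ⁺¹ n) (sym (2ⁿ+2ⁿ≡2ⁿ⁺¹ n)) i) ⟨
  indexOf (subsetAt (suc n) (Fin.cast (2ⁿ+2ⁿ≡2ⁿ⁺¹ n) i′))
    ≡⟨ cong indexOf (subsetAt-cast {n} i′) ⟩
  indexOf (subsetAt⊎ n (splitAt (2 ^ n) i′))
    ≡⟨ halves (splitAt (2 ^ n) i′) ⟩
  Fin.cast (2ⁿ+2ⁿ≡2ⁿ⁺¹ n) (join (2 ^ n) (2 ^ n) (splitAt (2 ^ n) i′))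
    ≡⟨ cong (Fin.cast (2ⁿ+2ⁿ≡2ⁿ⁺¹ n)) (join-splitAt (2 ^ n) (2 ^ n) i′) ⟩
  Fin.cast (2ⁿ+2ⁿ≡2ⁿ⁺¹ n) i′
    ≡⟨ cast-involutive (2ⁿ+2ⁿ≡2ⁿ⁺¹ n) (sym (2ⁿ+2ⁿ≡2ⁿ⁺¹ n)) i ⟩
  i ∎
  where
  i′ : Fin (2 ^ n + 2 ^ n)
  i′ = Fin.cast (sym (2ⁿ+2ⁿ≡2ⁿ⁺¹ n)) i
  halves : ∀ s → indexOf (subsetAt⊎ n s) ≡ Fin.cast (2ⁿ+2ⁿ≡2ⁿ⁺¹ n) (join (2 ^ n) (2 ^ n) s)
  halves (inj₁ j) = cong (λ j → Fin.cast (2ⁿ+2ⁿ≡2ⁿ⁺¹ n) (j ↑ˡ 2 ^ n)) (indexOf-subsetAt {n} j)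
  halves (inj₂ j) = cong (λ j → Fin.cast (2ⁿ+2ⁿ≡2ⁿ⁺¹ n) (2 ^ n ↑ʳ j)) (indexOf-subsetAt {n} j)

∈-subsets : ∀ {n} (X : Subset n) → X ∈ₗ toList (subsets n)
∈-subsets X = subst (_∈ₗ toList (subsets _)) (subsetAt-indexOf X) (∈-toList⁺ (∈-lookup (indexOf X) (subsets _)))

subsetAt-injective : ∀ {n} {i j : Fin (2 ^ n)} → subsetAt n i ≡ subsetAt n j → i ≡ j
subsetAt-injective {n} {i} {j} e = trans (sym (indexOf-subsetAt {n} i)) (trans (cong indexOf e) (indexOf-subsetAt {n} j))

∈-Up⁺ : ∀ {n} {X : Subset n} {i} → X ⊆ subsetAt n i → i ∈ Up X
∈-Up⁺ {X = X} X⊆ = ∈-tabulate⁺ (⌊⌋-complete (X ⊆? _) X⊆)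

∈-Up⁻ : ∀ {n} {X : Subset n} {i} → i ∈ Up X → X ⊆ subsetAt n i
∈-Up⁻ {X = X} i∈ = ⌊⌋-sound (X ⊆? _) (∈-tabulate⁻ i∈)

Up-∪ : ∀ {n} (X Y : Subset n) → Up X ∩ Up Y ≡ Up (X ∪ Y)
Up-∪ X Y = ⊆-antisym
  (λ i∈ → let i∈UpX , i∈UpY = x∈p∩q⁻ (Up X) (Up Y) i∈
          in ∈-Up⁺ (∪-lub (∈-Up⁻ i∈UpX) (∈-Up⁻ i∈UpY)))
  (λ i∈ → x∈p∩q⁺ (∈-Up⁺ (∈-Up⁻ i∈ ∘ p⊆p∪q Y) , ∈-Up⁺ (∈-Up⁻ i∈ ∘ q⊆p∪q X Y)))

Up-⊆⊥ : ∀ {n} {X : Subset n} → X ⊆ ⊥ → Up X ≡ ⊤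
Up-⊆⊥ X⊆⊥ = ⊆-antisym ⊆⊤ λ _ → ∈-Up⁺ λ x∈ → ⊥-elim (∉⊥ (X⊆⊥ x∈))

Cl-UpFam : ∀ {n} {R : List (Subset n)} {Z} → Cl (UpFam R) Z → ∃ λ Y → Z ≡ Up Y
Cl-UpFam (base (Y , _ , UpY≡Z)) = Y , sym UpY≡Z
Cl-UpFam (inter Z₁∈ Z₂∈) with Cl-UpFam Z₁∈ | Cl-UpFam Z₂∈
... | Y₁ , refl | Y₂ , refl = Y₁ ∪ Y₂ , Up-∪ Y₁ Y₂

-- Reaction systems

module _ {s : ℕ} where

  res₁-cases : ∀ (a : Reaction s) X → (enabled? a X ≡ true × res₁ a X ≡ P a) ⊎ res₁ a X ≡ ⊥
  res₁-cases a X with enabled? a X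
  ... | true  = inj₁ (refl , refl)
  ... | false = inj₂ refl

  res₁-enabled : ∀ {a : Reaction s} {X} → enabled? a X ≡ true → res₁ a X ≡ P a
  res₁-enabled {a} e = cong (if_then P a else ⊥) e

  res₁-disabled : ∀ {a : Reaction s} {X} → enabled? a X ≡ false → res₁ a X ≡ ⊥
  res₁-disabled {a} e = cong (if_then P a else ⊥) e

  res-⊆ : ∀ (A : List (Reaction s)) X {Y} →
          (∀ {a} → a ∈ₗ A → enabled? a X ≡ true → P a ⊆ Y) → res A X ⊆ Y
  res-⊆ []      X        _      = ⊥⊆
  res-⊆ (a ∷ A) X {Y} P⊆Y = ∪-lub res₁⊆ (res-⊆ A X (P⊆Y ∘ there))
    where
    res₁⊆ : res₁ a X ⊆ Y
    res₁⊆ with res₁-cases a X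
    ... | inj₁ (en , e) = subst (_⊆ Y) (sym e) (P⊆Y (here refl) en)
    ... | inj₂ e        = subst (_⊆ Y) (sym e) ⊥⊆

  P⊆res : ∀ {A : List (Reaction s)} {a X} → a ∈ₗ A → enabled? a X ≡ true → P a ⊆ res A X
  P⊆res {a ∷ A} {X = X} (here refl) en = p⊆p∪q (res A X) ∘ subst (_ ∈_) (sym (res₁-enabled {a} {X} en))
  P⊆res {b ∷ A} {X = X} (there a∈)  en = q⊆p∪q (res₁ b X) (res A X) ∘ P⊆res a∈ en

  res≡⊥ : ∀ (A : List (Reaction s)) X → (∀ a → enabled? a X ≡ false) → res A X ≡ ⊥
  res≡⊥ []      X disabled = refl
  res≡⊥ (a ∷ A) X disabled = begin
    res₁ a X ∪ res A X ≡⟨ cong₂ _∪_ (res₁-disabled {a} {X} (disabled a)) (res≡⊥ A X disabled) ⟩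
    ⊥ ∪ ⊥              ≡⟨ ∪-identityˡ ⊥ ⟩
    ⊥                  ∎

  disabled-⊥ : ∀ (a : Reaction s) → enabled? a ⊥ ≡ false
  disabled-⊥ a = cong (_∧ ⌊ ≡-dec Bool._≟_ (I a ∩ ⊥) ⊥ ⌋) (⌊⌋-refute (R a ⊆? ⊥) R⊈⊥)
    where
    R⊈⊥ : ¬ R a ⊆ ⊥
    R⊈⊥ R⊆⊥ = ∉⊥ (R⊆⊥ (proj₂ (R≠∅ a)))

  disabled-⊤ : ∀ (a : Reaction s) → enabled? a ⊤ ≡ false
  disabled-⊤ a = trans (cong (⌊ R a ⊆? ⊤ ⌋ ∧_) (⌊⌋-refute (≡-dec Bool._≟_ (I a ∩ ⊤) ⊥) I∩⊤≢⊥))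
                       (∧-zeroʳ ⌊ R a ⊆? ⊤ ⌋)
    where
    I∩⊤≢⊥ : I a ∩ ⊤ ≢ ⊥
    I∩⊤≢⊥ e = ∉⊥ (subst (_ ∈_) (trans (sym (∩-identityʳ (I a))) e) (proj₂ (I≠∅ a)))

module Realisation {s : ℕ} (g : Subset s → Subset s) where

  reactionAt : ∀ X → Nonempty X → Nonempty (∁ X) → Reaction s
  reactionAt X X≠∅ ∁X≠∅ = record { R = X ; I = ∁ X ; P = g X ; R≠∅ = X≠∅ ; I≠∅ = ∁X≠∅ }

  reactionAt-enabled-self : ∀ {X} X≠∅ ∁X≠∅ → enabled? (reactionAt X X≠∅ ∁X≠∅) X ≡ true
  reactionAt-enabled-self {X} _ _ =
    cong₂ _∧_ (⌊⌋-complete (X ⊆? X) ⊆-refl) (⌊⌋-complete (≡-dec Bool._≟_ (∁ X ∩ X) ⊥) (∩-inverseˡ X))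

  reactionAt-enabled : ∀ {X Z} X≠∅ ∁X≠∅ → enabled? (reactionAt X X≠∅ ∁X≠∅) Z ≡ true → X ≡ Z
  reactionAt-enabled {X} {Z} _ _ en = ⊆-antisym X⊆Z Z⊆X
    where
    X⊆Z : X ⊆ Z
    X⊆Z = ⌊⌋-sound (X ⊆? Z) (proj₁ (∧≡true en))
    ∁X∩Z≡⊥ : ∁ X ∩ Z ≡ ⊥
    ∁X∩Z≡⊥ = ⌊⌋-sound (≡-dec Bool._≟_ (∁ X ∩ Z) ⊥) (proj₂ (∧≡true en))
    Z⊆X : Z ⊆ X
    Z⊆X z∈Z = x∉∁p⇒x∈p λ z∈∁X → ∉⊥ (subst (_ ∈_) ∁X∩Z≡⊥ (x∈p∩q⁺ (z∈∁X , z∈Z)))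

  reactions : List (Subset s) → List (Reaction s)
  reactions []      = []
  reactions (X ∷ L) with nonempty? X | nonempty? (∁ X)
  ... | yes X≠∅ | yes ∁X≠∅ = reactionAt X X≠∅ ∁X≠∅ ∷ reactions L
  ... | _       | _        = reactions L

  ∈-reactions⁻ : ∀ {a} L → a ∈ₗ reactions L → ∃₂ λ X X≠∅ → ∃ λ ∁X≠∅ → a ≡ reactionAt X X≠∅ ∁X≠∅
  ∈-reactions⁻ (X ∷ L) a∈ with nonempty? X | nonempty? (∁ X) | a∈
  ... | yes X≠∅ | yes ∁X≠∅ | here a≡ = X , X≠∅ , ∁X≠∅ , a≡
  ... | yes _   | yes _    | there a∈′ = ∈-reactions⁻ L a∈′
  ... | yes _   | no _     | a∈′ = ∈-reactions⁻ L a∈′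
  ... | no _    | _        | a∈′ = ∈-reactions⁻ L a∈′

  ∈-reactions⁺ : ∀ {X} L → X ∈ₗ L → Nonempty X → Nonempty (∁ X) →
                 ∃₂ λ X≠∅ ∁X≠∅ → reactionAt X X≠∅ ∁X≠∅ ∈ₗ reactions L
  ∈-reactions⁺ (Y ∷ L) X∈ X≠∅ ∁X≠∅ with nonempty? Y | nonempty? (∁ Y) | X∈
  ... | yes Y≠∅ | yes ∁Y≠∅ | here refl = Y≠∅ , ∁Y≠∅ , here refl
  ... | yes _   | yes _    | there X∈′ = let p , q , r∈ = ∈-reactions⁺ L X∈′ X≠∅ ∁X≠∅ in p , q , there r∈
  ... | yes _   | no ∁Y=∅  | here refl = contradiction ∁X≠∅ ∁Y=∅
  ... | yes _   | no _     | there X∈′ = ∈-reactions⁺ L X∈′ X≠∅ ∁X≠∅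
  ... | no Y=∅  | _        | here refl = contradiction X≠∅ Y=∅
  ... | no _    | _        | there X∈′ = ∈-reactions⁺ L X∈′ X≠∅ ∁X≠∅

  realisation : List (Reaction s)
  realisation = reactions (toList (subsets s))

  res-realisation : ∀ {Z} → Nonempty Z → Nonempty (∁ Z) → res realisation Z ≡ g Z
  res-realisation {Z} Z≠∅ ∁Z≠∅ with ∈-reactions⁺ (toList (subsets s)) (∈-subsets Z) Z≠∅ ∁Z≠∅
  ... | Z≠∅′ , ∁Z≠∅′ , r∈ =
    ⊆-antisym (res-⊆ realisation Z products⊆) (P⊆res r∈ (reactionAt-enabled-self Z≠∅′ ∁Z≠∅′))
    where
    products⊆ : ∀ {a} → a ∈ₗ realisation → enabled? a Z ≡ true → P a ⊆ g Z
    products⊆ a∈ en with ∈-reactions⁻ (toList (subsets s)) a∈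
    ... | X , X≠∅ , ∁X≠∅ , refl = subst (λ Y → g X ⊆ g Y) (reactionAt-enabled X≠∅ ∁X≠∅ en) ⊆-refl

-- Transition graphs satisfy the conditions

module Forward {m k} (G : Graph m) (A : List (Reaction (suc k))) (f : Fin m → Subset (suc k))
               (f-bijective : Bijective _≡_ _≡_ f) (edges : ∀ v w → (w ∈ G v) ⇔ TransEdge A (f v) (f w)) where

  n : ℕ
  n = suc k

  f⁻¹ : Subset n → Fin m
  f⁻¹ Z = proj₁ (proj₂ f-bijective Z)

  f∘f⁻¹ : ∀ Z → f (f⁻¹ Z) ≡ Z
  f∘f⁻¹ Z = proj₂ (proj₂ f-bijective Z) refl

  f⁻¹∘f : ∀ v → f⁻¹ (f v) ≡ v
  f⁻¹∘f v = proj₁ f-bijective (f∘f⁻¹ (f v))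

  edge⁺ : ∀ {v w} → res A (f v) ⊆ f w → w ∈ G v
  edge⁺ {v} {w} = Equivalence.from (edges v w)

  edge⁻ : ∀ {v w} → w ∈ G v → res A (f v) ⊆ f w
  edge⁻ {v} {w} w∈ = Equivalence.to (edges v w) w∈

  vertexAt : Permutation (2 ^ n) m
  vertexAt = permutation (f⁻¹ ∘ subsetAt n) (indexOf ∘ f)
    (λ v → trans (cong f⁻¹ (subsetAt-indexOf (f v))) (f⁻¹∘f v))
    (λ i → trans (cong indexOf (f∘f⁻¹ (subsetAt n i))) (indexOf-subsetAt {n} i))

  η : Subset m → Subset (2 ^ n)
  η = preimage (vertexAt ⟨$⟩ʳ_)

  η-G : ∀ v → η (G v) ≡ Up (res A (f v))
  η-G v = ⊆-antisym
    (λ i∈ → ∈-Up⁺ (subst (res A (f v) ⊆_) (f∘f⁻¹ _) (edge⁻ (∈-preimage⁻ {h = vertexAt ⟨$⟩ʳ_} i∈))))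
    (λ i∈ → ∈-preimage⁺ {h = vertexAt ⟨$⟩ʳ_} (edge⁺ (subst (res A (f v) ⊆_) (sym (f∘f⁻¹ _)) (∈-Up⁻ i∈))))

  results : List (Subset n)
  results = List.map (res A ∘ f) (allFin m)

  faithful : FaithfulCorr (𝒪 G) (UpFam results) η
  faithful = faithfulCorr (preimage-∩ (vertexAt ⟨$⟩ʳ_)) (preimage-injective vertexAt) (sym ∘ ∣preimage∣ vertexAt)
                          η-gen η-gen⁻¹
    where
    η-gen : ∀ {X} → 𝒪 G X → UpFam results (η X)
    η-gen (v , refl) = res A (f v) , ∈-map⁺ (res A ∘ f) (∈-allFin v) , sym (η-G v)
    η-gen⁻¹ : ∀ {Z} → UpFam results Z → ∃ λ X → 𝒪 G X × η X ≡ Z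
    η-gen⁻¹ (Y , Y∈ , UpY≡Z) with ∈-map⁻ (res A ∘ f) Y∈
    ... | v , _ , refl = G v , (v , refl) , trans (η-G v) UpY≡Z

  v⊥ v⊤ : Fin m
  v⊥ = f⁻¹ ⊥
  v⊤ = f⁻¹ ⊤

  cond₃ : Cond₃ G
  cond₃ = v⊥ , v⊤ , v⊥-only-in-full , v⊤-everywhere , v⊥-loop , v⊤→v⊥
    where
    v⊥-only-in-full : ∀ v → G v ≢ ⊤ → v⊥ ∉ G v
    v⊥-only-in-full v Gv≢⊤ v⊥∈ =
      Gv≢⊤ (⊆-antisym ⊆⊤ λ _ → edge⁺ λ x∈ → ⊥-elim (∉⊥ (subst (_ ∈_) (f∘f⁻¹ ⊥) (edge⁻ v⊥∈ x∈))))
    v⊤-everywhere : ∀ v → v⊤ ∈ G v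
    v⊤-everywhere v = edge⁺ λ _ → subst (_ ∈_) (sym (f∘f⁻¹ ⊤)) ∈⊤
    v⊥-loop : v⊥ ∈ G v⊥
    v⊥-loop = edge⁺ (subst (λ X → res A X ⊆ X) (sym (f∘f⁻¹ ⊥)) (⊆-reflexive (res≡⊥ A ⊥ disabled-⊥)))
    v⊤→v⊥ : v⊥ ∈ G v⊤
    v⊤→v⊥ = edge⁺ (subst₂ (λ X Y → res A X ⊆ Y) (sym (f∘f⁻¹ ⊤)) (sym (f∘f⁻¹ ⊥))
                           (⊆-reflexive (res≡⊥ A ⊤ disabled-⊤)))

  conditions : Conditions G
  conditions = n , s≤s z≤n , sym (↔⇒≡ vertexAt) , (results , η , faithful) , cond₃

-- Graphs satisfying the conditions are transition graphs

module Backward {k} (G : Graph (2 ^ suc k)) {R : List (Subset (suc k))} {η : Subset (2 ^ suc k) → Subset (2 ^ suc k)}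
                (faithful : FaithfulCorr (𝒪 G) (UpFam R) η) (v⊥ v⊤ : Fin (2 ^ suc k))
                (v⊥-only-in-full : ∀ v → G v ≢ ⊤ → v⊥ ∉ G v) (v⊤-everywhere : ∀ v → v⊤ ∈ G v)
                (v⊥-loop : v⊥ ∈ G v⊥) (v⊤→v⊥ : v⊥ ∈ G v⊤) where

  open FaithfulCorr faithful

  n : ℕ
  n = suc k

  G-gen : ∀ v → 𝒪 G (G v)
  G-gen v = v , refl

  Y : Fin (2 ^ n) → Subset n
  Y v = proj₁ (Cl-UpFam (into (base (G-gen v))))

  η-G : ∀ v → η (G v) ≡ Up (Y v)
  η-G v = proj₂ (Cl-UpFam (into (base (G-gen v))))

  i⊥ i⊤ : Fin (2 ^ n)
  i⊥ = indexOf {n} ⊥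
  i⊤ = indexOf {n} ⊤

  i⊥∈⇒Y⊆⊥ : ∀ {v} → i⊥ ∈ η (G v) → Y v ⊆ ⊥
  i⊥∈⇒Y⊆⊥ {v} i⊥∈ = subst (Y v ⊆_) (subsetAt-indexOf {n} ⊥) (∈-Up⁻ (subst (i⊥ ∈_) (η-G v) i⊥∈))

  v⊥∈⇔i⊥∈ : ∀ v → (v⊥ ∈ G v) ⇔ (i⊥ ∈ η (G v))
  v⊥∈⇔i⊥∈ v = mk⇔ to from
    where
    Gv≡⊤ : v⊥ ∈ G v → G v ≡ ⊤
    Gv≡⊤ v⊥∈ with ≡-dec Bool._≟_ (G v) ⊤
    ... | yes Gv≡⊤ = Gv≡⊤
    ... | no  Gv≢⊤ = contradiction v⊥∈ (v⊥-only-in-full v Gv≢⊤)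
    to : v⊥ ∈ G v → i⊥ ∈ η (G v)
    to v⊥∈ = subst (i⊥ ∈_) (sym (full-preserved faithful (base (G-gen v)) (Gv≡⊤ v⊥∈))) ∈⊤
    from : i⊥ ∈ η (G v) → v⊥ ∈ G v
    from i⊥∈ = subst (v⊥ ∈_) (sym (full-reflected faithful (base (G-gen v)) ηGv≡⊤)) ∈⊤
      where
      ηGv≡⊤ : η (G v) ≡ ⊤
      ηGv≡⊤ = trans (η-G v) (Up-⊆⊥ (i⊥∈⇒Y⊆⊥ i⊥∈))

  Y⊆⊥ : ∀ {v} → v⊥ ∈ G v → Y v ⊆ ⊥
  Y⊆⊥ {v} = i⊥∈⇒Y⊆⊥ ∘ Equivalence.to (v⊥∈⇔i⊥∈ v)

  i⊤∈ : ∀ v → i⊤ ∈ η (G v)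
  i⊤∈ v = subst (i⊤ ∈_) (sym (η-G v)) (∈-Up⁺ (subst (Y v ⊆_) (sym (subsetAt-indexOf {n} ⊤)) ⊆⊤))

  v⊥-column : column G v⊥ ≡ column (η ∘ G) i⊥
  v⊥-column = column-≡ v⊥∈⇔i⊥∈

  v⊤-column : column G v⊤ ≡ column (η ∘ G) i⊤
  v⊤-column = column-≡ λ v → mk⇔ (λ _ → i⊤∈ v) (λ _ → v⊤-everywhere v)

  -- No reaction is enabled at ∅ or at the full set, so the vertices sent there must have Y = ∅.
  record Arrangement : Set where
    field
      π       : Permutation (2 ^ n) (2 ^ n)
      matches : Matches π (column G) (column (η ∘ G))
      at-i⊥   : ∀ w → π ⟨$⟩ʳ w ≡ i⊥ → v⊥ ∈ G w
      at-i⊤   : ∀ w → π ⟨$⟩ʳ w ≡ i⊤ → v⊥ ∈ G w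

  sole-preimage : ∀ (π : Permutation (2 ^ n) (2 ^ n)) {x y} → π ⟨$⟩ʳ x ≡ y → v⊥ ∈ G x →
                  ∀ w → π ⟨$⟩ʳ w ≡ y → v⊥ ∈ G w
  sole-preimage π x↦y v⊥∈ w w↦y = subst (λ u → v⊥ ∈ G u) (⟨$⟩ʳ-injective π (trans x↦y (sym w↦y))) v⊥∈

  arrangement : Arrangement
  arrangement with v⊥ Finₚ.≟ v⊤
  ... | yes refl =
    let π , matches , v⊥↦i⊥ = matching-through (column G) (column (η ∘ G)) v⊥-column
                                (column-fibres faithful G G-gen)
    in record { π = π ; matches = matches
              ; at-i⊥ = sole-preimage π v⊥↦i⊥ v⊥-loop ; at-i⊤ = λ w _ → v⊤-everywhere w }
  ... | no v⊥≢v⊤ =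
    let π , matches , v⊥↦i⊥ , v⊤↦i⊤ = matching-through₂ (column G) (column (η ∘ G)) v⊥≢v⊤ i⊥≢i⊤ v⊥-column v⊤-column
                                        (column-fibres faithful G G-gen)
    in record { π = π ; matches = matches
              ; at-i⊥ = sole-preimage π v⊥↦i⊥ v⊥-loop ; at-i⊤ = sole-preimage π v⊤↦i⊤ v⊤→v⊥ }
    where
    i⊥≢i⊤ : i⊥ ≢ i⊤
    i⊥≢i⊤ e with trans (sym (subsetAt-indexOf {n} ⊥)) (trans (cong (subsetAt n) e) (subsetAt-indexOf {n} ⊤))
    ... | ()

  open Arrangement arrangement

  F : Fin (2 ^ n) → Subset n
  F w = subsetAt n (π ⟨$⟩ʳ w)

  F-injective : ∀ {v w} → F v ≡ F w → v ≡ w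
  F-injective = ⟨$⟩ʳ-injective π ∘ subsetAt-injective {n}

  F⁻¹ : Subset n → Fin (2 ^ n)
  F⁻¹ Z = π ⟨$⟩ˡ indexOf Z

  F∘F⁻¹ : ∀ Z → F (F⁻¹ Z) ≡ Z
  F∘F⁻¹ Z = trans (cong (subsetAt n) (inverseʳ π)) (subsetAt-indexOf Z)

  F⁻¹∘F : ∀ w → F⁻¹ (F w) ≡ w
  F⁻¹∘F w = trans (cong (π ⟨$⟩ˡ_) (indexOf-subsetAt {n} (π ⟨$⟩ʳ w))) (inverseˡ π)

  π-at : ∀ {w Z} → F w ≡ Z → π ⟨$⟩ʳ w ≡ indexOf Z
  π-at {w} Fw≡Z = trans (sym (indexOf-subsetAt {n} (π ⟨$⟩ʳ w))) (cong indexOf Fw≡Z)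

  edge⇔ : ∀ v w → (w ∈ G v) ⇔ (Y v ⊆ F w)
  edge⇔ v w = mk⇔ to from
    where
    to : w ∈ G v → Y v ⊆ F w
    to w∈ = ∈-Up⁻ (subst (π ⟨$⟩ʳ w ∈_) (η-G v)
                   (∈-column⁻ {Xs = η ∘ G} (subst (v ∈_) (sym (matches w)) (∈-column⁺ {Xs = G} w∈))))
    from : Y v ⊆ F w → w ∈ G v
    from Y⊆ = ∈-column⁻ {Xs = G} (subst (v ∈_) (matches w)
                (∈-column⁺ {Xs = η ∘ G} (subst (π ⟨$⟩ʳ w ∈_) (sym (η-G v)) (∈-Up⁺ Y⊆))))

  open Realisation (Y ∘ F⁻¹) using (realisation; res-realisation)

  degenerate : ∀ {w Z} → F w ≡ Z → (∀ a → enabled? a Z ≡ false) → v⊥ ∈ G w → res realisation (F w) ≡ Y w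
  degenerate {Z = Z} Fw≡Z disabled v⊥∈ =
    trans (cong (res realisation) Fw≡Z) (trans (res≡⊥ realisation Z disabled) (sym (⊆-antisym (Y⊆⊥ v⊥∈) ⊥⊆)))

  res-F : ∀ w → res realisation (F w) ≡ Y w
  res-F w with nonempty? (F w) | nonempty? (∁ (F w))
  ... | yes Fw≠∅ | yes ∁Fw≠∅ = trans (res-realisation Fw≠∅ ∁Fw≠∅) (cong Y (F⁻¹∘F w))
  ... | no Fw=∅  | _         = degenerate Fw≡⊥ disabled-⊥ (at-i⊥ w (π-at Fw≡⊥))
    where
    Fw≡⊥ : F w ≡ ⊥
    Fw≡⊥ = Empty-unique Fw=∅
  ... | yes _    | no ∁Fw=∅  = degenerate Fw≡⊤ disabled-⊤ (at-i⊤ w (π-at Fw≡⊤))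
    where
    Fw≡⊤ : F w ≡ ⊤
    Fw≡⊤ = ⊆-antisym ⊆⊤ λ _ → x∉∁p⇒x∈p λ x∈∁ → ∁Fw=∅ (_ , x∈∁)

  isRSTransitionGraph : IsRSTransitionGraph G
  isRSTransitionGraph = k , realisation , F , (F-injective , λ Z → F⁻¹ Z , λ { refl → F∘F⁻¹ Z }) , edges
    where
    edges : ∀ v w → (w ∈ G v) ⇔ TransEdge realisation (F v) (F w)
    edges v w = mk⇔ to from
      where
      to : w ∈ G v → res realisation (F v) ⊆ F w
      to w∈ = subst (_⊆ F w) (sym (res-F v)) (Equivalence.to (edge⇔ v w) w∈)
      from : res realisation (F v) ⊆ F w → w ∈ G v
      from res⊆ = Equivalence.from (edge⇔ v w) (subst (_⊆ F w) (res-F v) res⊆)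

theorem5p6 : ∀ (m : ℕ) (G : Graph m) → IsRSTransitionGraph G ⇔ Conditions G
theorem5p6 m G = mk⇔ necessary sufficient
  where
  necessary : IsRSTransitionGraph G → Conditions G
  necessary (k , A , f , f-bijective , edges) = Forward.conditions G A f f-bijective edges

  sufficient : Conditions G → IsRSTransitionGraph G
  sufficient (zero  , ()    , _)
  sufficient (suc k , _ , refl , (_ , _ , faithful) , v⊥ , v⊤ , only-in-full , everywhere , loop , v⊤→v⊥) =
    Backward.isRSTransitionGraph G faithful v⊥ v⊤ only-in-full everywhere loop v⊤→v⊥
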